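{- Let $M$ be a nested matroid on a ground set $E$ and let $\trianglelefteq$ be a left-justified order of $M$. Then for all disjoint $X,Y\subseteq E$ and all $B\subseteq E\setminus(X\cup Y)$ with $|B|=r(M\setminus X/Y)$, the set $B$ is a basis of $M\setminus X/Y$ if and only if $B\le_{\trianglelefteq}G(M\setminus X/Y,\trianglelefteq)$.
   Context: $M$ is nested if there are $A_1\subseteq\cdots\subseteq A_m\subseteq E$ such that $I\subseteq E$ is independent iff there is an injection $\varphi\colon I\to\{1,\ldots,m\}$ with $e\in A_{\varphi(e)}$ for all $e\in I$. $M\setminus X/Y$ is the minor obtained by deleting $X$ and contracting $Y$, and $r(N)$ denotes the rank of a matroid $N$. For a total order $\preceq$ on a set and $k$-element subsets $X',Y'$ whose elements in increasing order are $x_1\prec\cdots\prec x_k$ and $y_1\prec\cdots\prec y_k$, the Gale order is $X'\le_{\preceq}Y'$ iff $x_j\preceq y_j$ for all $j$. For a matroid $N$ and a total order $\preceq$ on its ground set (here the order induced on the ground set), the Gale basis $G(N,\preceq)$ is the unique basis of $N$ with $B'\le_{\preceq}G(N,\preceq)$ for every basis $B'$. A left-justified order of $M$ is a total order $\trianglelefteq$ on $E$ such that a subset $B$ of size $r(M)$ is a basis of $M$ iff $B\le_{\trianglelefteq}G(M,\trianglelefteq)$. -}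

module Defs where

open import Level using (0ℓ)
open import Data.Nat using (ℕ; _<_)
open import Data.Fin using (Fin)
import Data.Fin as F
open import Data.Fin.Subset using (Subset; _∈_; _∉_; _⊆_; _∪_; _∩_; ∁; ⊥; ⁅_⁆; ∣_∣)
open import Data.Product using (Σ; ∃; _×_; _,_)
open import Relation.Binary.PropositionalEquality using (_≡_; _≢_)
open import Relation.Binary.Core using (Rel)
open import Function.Bundles using (_⇔_)

record Matroid (n : ℕ) : Set₁ where
  field
    Indep       : Subset n → Set
    indep-empty : Indep ⊥
    indep-down  : ∀ {I J} → I ⊆ J → Indep J → Indep I
    indep-aug   : ∀ {I J} → Indep I → Indep J → ∣ I ∣ < ∣ J ∣ →
                  Σ (Fin n) λ e → e ∈ J × e ∉ I × Indep (⁅ e ⁆ ∪ I)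
open Matroid public

IsChain : ∀ {n m} → (Fin m → Subset n) → Set
IsChain {m = m} A = ∀ (i j : Fin m) → i F.≤ j → A i ⊆ A j

MatchesInto : ∀ {n m} → (Fin m → Subset n) → Subset n → Set
MatchesInto {n} {m} A I =
  Σ ((e : Fin n) → e ∈ I → Fin m) λ φ →
    (∀ e (p : e ∈ I) → e ∈ A (φ e p)) ×
    (∀ e e' (p : e ∈ I) (p' : e' ∈ I) → φ e p ≡ φ e' p' → e ≡ e')

IsNested : ∀ {n} → Matroid n → Set
IsNested {n} M =
  Σ ℕ λ m → Σ (Fin m → Subset n) λ A →
    IsChain A × (∀ (I : Subset n) → Indep M I ⇔ MatchesInto A I)

IsBasis : ∀ {n} → (Subset n → Set) → Subset n → Set
IsBasis Ind B = Ind B × (∀ J → B ⊆ J → Ind J → J ≡ B)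

-- r(N) = k : k is the size of a basis (all bases have the same size)
HasRank : ∀ {n} → (Subset n → Set) → ℕ → Set
HasRank Ind k = Σ _ λ B → IsBasis Ind B × ∣ B ∣ ≡ k

RestrictIndep : ∀ {n} → Matroid n → Subset n → Subset n → Set
RestrictIndep M Y I = I ⊆ Y × Indep M I

MinorIndep : ∀ {n} → Matroid n → Subset n → Subset n → Subset n → Set
MinorIndep M X Y I =
  I ⊆ ∁ (X ∪ Y) ×
  Σ _ λ BY → IsBasis (RestrictIndep M Y) BY × Indep M (I ∪ BY)

IsIncEnum : ∀ {n} → Rel (Fin n) 0ℓ → Subset n → (k : ℕ) → (Fin k → Fin n) → Set
IsIncEnum {n} _⊴_ S k x =
  (∀ (i j : Fin k) → i F.< j → (x i ⊴ x j) × (x i ≢ x j)) ×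
  (∀ (e : Fin n) → e ∈ S ⇔ ∃ λ i → x i ≡ e)

GaleLeq : ∀ {n} → Rel (Fin n) 0ℓ → Subset n → Subset n → Set
GaleLeq {n} _⊴_ X' Y' =
  ∣ X' ∣ ≡ ∣ Y' ∣ ×
  (∀ (k : ℕ) (x y : Fin k → Fin n) →
     IsIncEnum _⊴_ X' k x → IsIncEnum _⊴_ Y' k y →
     ∀ (j : Fin k) → x j ⊴ y j)

IsGaleBasis : ∀ {n} → Rel (Fin n) 0ℓ → (Subset n → Set) → Subset n → Set
IsGaleBasis _⊴_ Ind G =
  IsBasis Ind G × (∀ B' → IsBasis Ind B' → GaleLeq _⊴_ B' G)

IsLeftJustified : ∀ {n} → Matroid n → Rel (Fin n) 0ℓ → Set
IsLeftJustified M _⊴_ =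
  ∀ G → IsGaleBasis _⊴_ (Indep M) G →
  ∀ (B : Subset _) → HasRank (Indep M) ∣ B ∣ →
  (IsBasis (Indep M) B ⇔ GaleLeq _⊴_ B G)

-- For sets of equal size, P is Gale below Q iff |P ∩ ↑t| ≤ |Q ∩ ↑t| for every t, where
-- ↑t = {e | t ⊴ e}; so the Gale order is transitive and adding a common disjoint set S
-- preserves it. Let G be the Gale basis of M \ X / Y, independent together with a basis BY of
-- M | Y, and extend G ∪ BY to a basis D of M. The new elements S = D ─ G avoid the ground set
-- of the minor, so for B Gale below G we get B ∪ S ≤ G ∪ S = D ≤ G(M, ⊴). By left-justification
-- B ∪ S is a basis of M; it contains B ∪ BY, so B is independent in the minor and has its rank.
-- Nestedness only serves to decide independence, which the greedy construction of G(M, ⊴) needs.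

module Submission where

open import Defs
open import Level using (0ℓ)
open import Function using (_∘_; id)
open import Function.Bundles using (_⇔_; mk⇔; Equivalence)
open import Data.Empty using (⊥-elim)
open import Data.Product using (Σ; ∃; _×_; _,_; proj₁; proj₂)
open import Data.Sum using (inj₁; inj₂)
open import Data.Nat using (ℕ; zero; suc; _+_; _≤_; _<_; z≤n; s≤s; _≤?_)
open import Data.Nat.Properties
  using (module ≤-Reasoning; ≤-trans; ≤-reflexive; ≤-antisym; <⇒≱; ≰⇒>; +-suc; +-identityʳ;
         m≤m+n; m≤n+m; +-monoˡ-≤; +-mono-<-≤; suc-injective)
open import Data.Fin using (Fin; zero; suc)
import Data.Fin as F
import Data.Fin.Properties as Fₚ
open import Data.Fin.Subset
  using (Subset; inside; outside; _∈_; _∉_; _⊆_; _∪_; _∩_; _─_; _-_; ∁; ⊥; ⊤; ⁅_⁆; ∣_∣; Nonempty)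
open import Data.Fin.Subset.Properties
  using (_∈?_; ⊆-antisym; p⊂q⇒∣p∣<∣q∣; p─⊥≡p; x∈⁅x⁆; x∈⁅y⁆⇒x≡y; ∣⁅x⁆∣≡1; x∈p∧x≢y⇒x∈p-y;
         x∈p∧x∉q⇒x∈p─q; x∈∁p⇒x∉p; ∪-assoc; p─q⊆p; x∈p∪q⁻; p⊆p∪q; q⊆p∪q; x∈p∩q⁻; x∈p∩q⁺;
         p∩q⊆p; p∩q⊆q; ∩-distribʳ-∪; nonempty?; Empty-unique; ∣⊥∣≡0; ∉⊥; ∈⊤; ∣⊤∣≡n)
open import Data.Vec using (_∷_; []; here; there; tabulate)
open import Data.Vec.Properties using ([]=⇒lookup; lookup⇒[]=; lookup∘tabulate)
import Data.Vec.Functional as Vector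
open import Data.List using (allFin; filter)
import Data.List.Relation.Unary.All as All
open import Data.List.Relation.Unary.All.Properties using (all-filter)
open import Data.List.Membership.Propositional.Properties using (∈-allFin; ∈-filter⁺)
import Data.List.Extrema
open import Relation.Nullary using (¬_; Dec; yes; no; contradiction)
open import Relation.Nullary.Decidable using (does; dec-true; map′; ¬?; _×-dec_; _→-dec_)
open import Relation.Binary.Core using (Rel)
open import Relation.Binary.Bundles using (TotalOrder)
open import Relation.Binary.Structures using (IsTotalOrder)
open import Relation.Binary.Definitions using (tri<; tri≈; tri>)
open import Relation.Binary.Consequences using (total∧dec⇒dec)
open import Relation.Binary.PropositionalEquality
  using (_≡_; _≢_; refl; sym; trans; cong; subst; module ≡-Reasoning)

private variable
  n m : ℕ
  p q r : Subset n
  x y : Fin n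

Disjoint : Subset n → Subset n → Set
Disjoint p q = ∀ {x} → x ∈ p → x ∉ q

∪-lub : p ⊆ r → q ⊆ r → p ∪ q ⊆ r
∪-lub {p = p} {q = q} p⊆r q⊆r x∈p∪q with x∈p∪q⁻ p q x∈p∪q
... | inj₁ x∈p = p⊆r x∈p
... | inj₂ x∈q = q⊆r x∈q

x∈p⇒⁅x⁆⊆p : x ∈ p → ⁅ x ⁆ ⊆ p
x∈p⇒⁅x⁆⊆p {x = x} x∈p y∈⁅x⁆ = subst (_∈ _) (sym (x∈⁅y⁆⇒x≡y x y∈⁅x⁆)) x∈p

x∈⁅x⁆∪p : ∀ (x : Fin n) p → x ∈ ⁅ x ⁆ ∪ p
x∈⁅x⁆∪p x p = p⊆p∪q p (x∈⁅x⁆ x)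

x∈p─q⇒x∉q : ∀ (p q : Subset n) → x ∈ p ─ q → x ∉ q
x∈p─q⇒x∉q (inside  ∷ p) (outside ∷ q) here        ()
x∈p─q⇒x∉q (_       ∷ p) (_       ∷ q) (there x∈p─q) (there x∈q) = x∈p─q⇒x∉q p q x∈p─q x∈q

x∈p-y⇒x≢y : ∀ p → x ∈ p - y → x ≢ y
x∈p-y⇒x≢y {x = x} p x∈p-y refl = x∈p─q⇒x∉q p ⁅ x ⁆ x∈p-y (x∈⁅x⁆ x)

∣p∣≡1+∣p-x∣ : x ∈ p → ∣ p ∣ ≡ suc ∣ p - x ∣
∣p∣≡1+∣p-x∣ {p = inside  ∷ p} here        = cong (suc ∘ ∣_∣) (sym (p─⊥≡p p))
∣p∣≡1+∣p-x∣ {p = inside  ∷ p} (there x∈p) = cong suc (∣p∣≡1+∣p-x∣ x∈p)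
∣p∣≡1+∣p-x∣ {p = outside ∷ p} (there x∈p) = ∣p∣≡1+∣p-x∣ x∈p

∣p∪q∣≡∣p∣+∣q∣ : ∀ (p q : Subset n) → Disjoint p q → ∣ p ∪ q ∣ ≡ ∣ p ∣ + ∣ q ∣
∣p∪q∣≡∣p∣+∣q∣ []            []            _ = refl
∣p∪q∣≡∣p∣+∣q∣ (inside  ∷ p) (inside  ∷ q) d = ⊥-elim (d here here)
∣p∪q∣≡∣p∣+∣q∣ (inside  ∷ p) (outside ∷ q) d = cong suc (∣p∪q∣≡∣p∣+∣q∣ p q (λ x∈p → d (there x∈p) ∘ there))
∣p∪q∣≡∣p∣+∣q∣ (outside ∷ p) (inside  ∷ q) d =
  trans (cong suc (∣p∪q∣≡∣p∣+∣q∣ p q (λ x∈p → d (there x∈p) ∘ there))) (sym (+-suc ∣ p ∣ ∣ q ∣))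
∣p∪q∣≡∣p∣+∣q∣ (outside ∷ p) (outside ∷ q) d = ∣p∪q∣≡∣p∣+∣q∣ p q (λ x∈p → d (there x∈p) ∘ there)

p⊆q⇒p∪[q─p]≡q : p ⊆ q → p ∪ (q ─ p) ≡ q
p⊆q⇒p∪[q─p]≡q {p = p} {q = q} p⊆q = ⊆-antisym (∪-lub p⊆q (p─q⊆p q p)) q⊆p∪[q─p]
  where
  q⊆p∪[q─p] : q ⊆ p ∪ (q ─ p)
  q⊆p∪[q─p] {x} x∈q with x ∈? p
  ... | yes x∈p = p⊆p∪q _ x∈p
  ... | no  x∉p = q⊆p∪q p _ (x∈p∧x∉q⇒x∈p─q x∈q x∉p)

∣⁅x⁆∪p∣≡1+∣p∣ : x ∉ p → ∣ ⁅ x ⁆ ∪ p ∣ ≡ suc ∣ p ∣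
∣⁅x⁆∪p∣≡1+∣p∣ {x = x} {p = p} x∉p = trans (∣p∪q∣≡∣p∣+∣q∣ ⁅ x ⁆ p ⁅x⁆#p) (cong (_+ ∣ p ∣) (∣⁅x⁆∣≡1 x))
  where
  ⁅x⁆#p : Disjoint ⁅ x ⁆ p
  ⁅x⁆#p y∈⁅x⁆ = subst (_∉ p) (sym (x∈⁅y⁆⇒x≡y x y∈⁅x⁆)) x∉p

∣[p∪q]∩r∣≡∣p∩r∣+∣q∩r∣ : ∀ (p q r : Subset n) → Disjoint p q → ∣ (p ∪ q) ∩ r ∣ ≡ ∣ p ∩ r ∣ + ∣ q ∩ r ∣
∣[p∪q]∩r∣≡∣p∩r∣+∣q∩r∣ p q r d = trans (cong ∣_∣ (∩-distribʳ-∪ r p q))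
  (∣p∪q∣≡∣p∣+∣q∣ (p ∩ r) (q ∩ r) (λ x∈p∩r x∈q∩r → d (proj₁ (x∈p∩q⁻ p r x∈p∩r)) (proj₁ (x∈p∩q⁻ q r x∈q∩r))))

p⊆q∧∣q∣≤∣p∣⇒p≡q : p ⊆ q → ∣ q ∣ ≤ ∣ p ∣ → p ≡ q
p⊆q∧∣q∣≤∣p∣⇒p≡q {p = p} {q = q} p⊆q ∣q∣≤∣p∣ = ⊆-antisym p⊆q q⊆p
  where
  q⊆p : q ⊆ p
  q⊆p {x} x∈q with x ∈? p
  ... | yes x∈p = x∈p
  ... | no  x∉p = contradiction ∣q∣≤∣p∣ (<⇒≱ (p⊂q⇒∣p∣<∣q∣ (p⊆q , x , x∈q , x∉p)))

∣p∣≡0⇒x∉p : ∣ p ∣ ≡ 0 → x ∉ p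
∣p∣≡0⇒x∉p ∣p∣≡0 x∈p with trans (sym ∣p∣≡0) (∣p∣≡1+∣p-x∣ x∈p)
... | ()

∣p∣≡1+k⇒Nonempty : ∀ {k} (p : Subset n) → ∣ p ∣ ≡ suc k → Nonempty p
∣p∣≡1+k⇒Nonempty {n} p ∣p∣≡1+k with nonempty? p
... | yes p≢∅ = p≢∅
... | no  p≡∅ with trans (sym ∣p∣≡1+k) (trans (cong ∣_∣ (Empty-unique p≡∅)) (∣⊥∣≡0 n))
...   | ()

injection⇒∣p∣≤∣q∣ : ∀ (p : Subset n) (q : Subset m) (f : ∀ x → x ∈ p → Fin m) →
  (∀ x x∈p → f x x∈p ∈ q) → (∀ x y x∈p y∈p → f x x∈p ≡ f y y∈p → x ≡ y) → ∣ p ∣ ≤ ∣ q ∣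
injection⇒∣p∣≤∣q∣ []            q f f∈q f-inj = z≤n
injection⇒∣p∣≤∣q∣ (outside ∷ p) q f f∈q f-inj =
  injection⇒∣p∣≤∣q∣ p q (λ x → f (suc x) ∘ there) (λ x → f∈q (suc x) ∘ there)
    (λ x y x∈p y∈p → Fₚ.suc-injective ∘ f-inj (suc x) (suc y) (there x∈p) (there y∈p))
injection⇒∣p∣≤∣q∣ (inside ∷ p) q f f∈q f-inj =
  subst (suc ∣ p ∣ ≤_) (sym (∣p∣≡1+∣p-x∣ (f∈q zero here)))
    (s≤s (injection⇒∣p∣≤∣q∣ p (q - f zero here) (λ x → f (suc x) ∘ there)
      (λ x x∈p → x∈p∧x≢y⇒x∈p-y (f∈q (suc x) (there x∈p)) (Fₚ.0≢1+n ∘ sym ∘ f-inj (suc x) zero (there x∈p) here))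
      (λ x y x∈p y∈p → Fₚ.suc-injective ∘ f-inj (suc x) (suc y) (there x∈p) (there y∈p))))

module GaleOrder {_⊴_ : Rel (Fin n) 0ℓ} (⊴-isTotalOrder : IsTotalOrder _≡_ _⊴_) where
  open IsTotalOrder ⊴-isTotalOrder using (total; antisym; reflexive)
    renaming (refl to ⊴-refl; trans to ⊴-trans)

  _⊴?_ : ∀ x y → Dec (x ⊴ y)
  _⊴?_ = total∧dec⇒dec reflexive antisym total Fₚ._≟_

  ↑_ : Fin n → Subset n
  ↑ t = tabulate (λ e → does (t ⊴? e))

  ∈↑⁺ : ∀ {t e} → t ⊴ e → e ∈ ↑ t
  ∈↑⁺ {t} {e} t⊴e = lookup⇒[]= e (↑ t) (trans (lookup∘tabulate _ e) (dec-true (t ⊴? e) t⊴e))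

  ∈↑⁻ : ∀ {t e} → e ∈ ↑ t → t ⊴ e
  ∈↑⁻ {t} {e} e∈↑t with t ⊴? e | trans (sym (lookup∘tabulate (λ e → does (t ⊴? e)) e)) ([]=⇒lookup e∈↑t)
  ... | yes t⊴e | _  = t⊴e
  ... | no  _   | ()

  ⊴-totalOrder : TotalOrder 0ℓ 0ℓ 0ℓ
  ⊴-totalOrder = record { isTotalOrder = ⊴-isTotalOrder }

  minimum : ∀ (S : Subset n) → Nonempty S → ∃ λ m → m ∈ S × (∀ {e} → e ∈ S → m ⊴ e)
  minimum S (m₀ , m₀∈S) =
    min m₀ xs , argmin-all id m₀∈S (all-filter (_∈? S) (allFin n)) ,
    λ e∈S → All.lookup (min≤xs m₀ xs) (∈-filter⁺ (_∈? S) (∈-allFin _) e∈S)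
    where
    open Data.List.Extrema ⊴-totalOrder using (min; min≤xs; argmin-all)
    xs = filter (_∈? S) (allFin n)

  incEnum : ∀ k (S : Subset n) → ∣ S ∣ ≡ k → Σ (Fin k → Fin n) (IsIncEnum _⊴_ S k)
  incEnum zero    S ∣S∣≡0 = (λ ()) , (λ ()) , λ e → mk⇔ (λ e∈S → contradiction e∈S (∣p∣≡0⇒x∉p ∣S∣≡0)) λ ()
  incEnum (suc k) S ∣S∣≡1+k with minimum S (∣p∣≡1+k⇒Nonempty S ∣S∣≡1+k)
  ... | m , m∈S , m-min with incEnum k (S - m) (suc-injective (trans (sym (∣p∣≡1+∣p-x∣ m∈S)) ∣S∣≡1+k))
  ... | x , x-inc , x-enum = m Vector.∷ x , inc , enum
    where
    x∈S-m : ∀ i → x i ∈ S - m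
    x∈S-m i = Equivalence.from (x-enum (x i)) (i , refl)
    inc : ∀ i j → i F.< j → ((m Vector.∷ x) i ⊴ (m Vector.∷ x) j) × ((m Vector.∷ x) i ≢ (m Vector.∷ x) j)
    inc zero    (suc j) _       = m-min (p─q⊆p S _ (x∈S-m j)) , x∈p-y⇒x≢y S (x∈S-m j) ∘ sym
    inc (suc i) (suc j) (s≤s i<j) = x-inc i j i<j
    enum : ∀ e → e ∈ S ⇔ ∃ λ i → (m Vector.∷ x) i ≡ e
    enum e = mk⇔ to from
      where
      to : e ∈ S → ∃ λ i → (m Vector.∷ x) i ≡ e
      to e∈S with e Fₚ.≟ m
      ... | yes refl = zero , refl
      ... | no  e≢m  = let i , xi≡e = Equivalence.to (x-enum e) (x∈p∧x≢y⇒x∈p-y e∈S e≢m) in suc i , xi≡e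
      from : (∃ λ i → (m Vector.∷ x) i ≡ e) → e ∈ S
      from (zero  , refl) = m∈S
      from (suc i , refl) = p─q⊆p S _ (x∈S-m i)

  module _ {S : Subset n} {k} {x : Fin k → Fin n} (x-enum : IsIncEnum _⊴_ S k x) where

    incEnum-injective : ∀ i j → x i ≡ x j → i ≡ j
    incEnum-injective i j xi≡xj with Fₚ.<-cmp i j
    ... | tri< i<j _ _ = contradiction xi≡xj (proj₂ (proj₁ x-enum i j i<j))
    ... | tri≈ _ i≡j _ = i≡j
    ... | tri> _ _ j<i = contradiction (sym xi≡xj) (proj₂ (proj₁ x-enum j i j<i))

    incEnum-∈ : ∀ i → x i ∈ S
    incEnum-∈ i = Equivalence.from (proj₂ x-enum (x i)) (i , refl)

    index : ∀ {e} → e ∈ S → Fin k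
    index e∈S = proj₁ (Equivalence.to (proj₂ x-enum _) e∈S)

    x[index]≡ : ∀ {e} (e∈S : e ∈ S) → x (index e∈S) ≡ e
    x[index]≡ e∈S = proj₂ (Equivalence.to (proj₂ x-enum _) e∈S)

  UpCountLeq : Subset n → Subset n → Set
  UpCountLeq P Q = ∀ t → ∣ P ∩ ↑ t ∣ ≤ ∣ Q ∩ ↑ t ∣

  module _ {P Q : Subset n} {k} {x y : Fin k → Fin n}
           (x-enum : IsIncEnum _⊴_ P k x) (y-enum : IsIncEnum _⊴_ Q k y) where

    -- x i ↦ y i maps P ∩ ↑ t injectively into Q ∩ ↑ t.
    pointwise⇒upCountLeq : (∀ j → x j ⊴ y j) → UpCountLeq P Q
    pointwise⇒upCountLeq x⊴y t = injection⇒∣p∣≤∣q∣ (P ∩ ↑ t) (Q ∩ ↑ t) f f∈Q∩↑t f-inj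
      where
      i : ∀ {e} → e ∈ P ∩ ↑ t → Fin k
      i e∈ = index x-enum (proj₁ (x∈p∩q⁻ P (↑ t) e∈))
      f : ∀ e → e ∈ P ∩ ↑ t → Fin n
      f _ e∈ = y (i e∈)
      f∈Q∩↑t : ∀ e e∈ → f e e∈ ∈ Q ∩ ↑ t
      f∈Q∩↑t e e∈ = x∈p∩q⁺ (incEnum-∈ y-enum (i e∈) , ∈↑⁺ (⊴-trans t⊴e (subst (_⊴ y (i e∈)) x[i]≡e (x⊴y (i e∈)))))
        where
        t⊴e = ∈↑⁻ (proj₂ (x∈p∩q⁻ P (↑ t) e∈))
        x[i]≡e = x[index]≡ x-enum (proj₁ (x∈p∩q⁻ P (↑ t) e∈))
      f-inj : ∀ e e′ e∈ e′∈ → f e e∈ ≡ f e′ e′∈ → e ≡ e′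
      f-inj e e′ e∈ e′∈ fe≡fe′ = begin
        e            ≡⟨ sym (x[index]≡ x-enum _) ⟩
        x (i e∈)     ≡⟨ cong x (incEnum-injective y-enum _ _ fe≡fe′) ⟩
        x (i e′∈)    ≡⟨ x[index]≡ x-enum _ ⟩
        e′           ∎
        where open ≡-Reasoning

    -- If y j ◁ x j, then y i ↦ x i maps Q ∩ ↑ x j injectively into (P ∩ ↑ x j) - x j,
    -- since every y i ⊵ x j has i > j.
    upCountLeq⇒pointwise : UpCountLeq P Q → ∀ j → x j ⊴ y j
    upCountLeq⇒pointwise P≤Q j with x j ⊴? y j
    ... | yes xj⊴yj = xj⊴yj
    ... | no  xj⋬yj = contradiction (≤-trans (P≤Q (x j)) ∣Q∩↑xj∣≤∣T∣) (<⇒≱ ∣T∣<∣P∩↑xj∣)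
      where
      T = P ∩ ↑ x j - x j
      ∣T∣<∣P∩↑xj∣ : ∣ T ∣ < ∣ P ∩ ↑ x j ∣
      ∣T∣<∣P∩↑xj∣ = ≤-reflexive (sym (∣p∣≡1+∣p-x∣ (x∈p∩q⁺ (incEnum-∈ x-enum j , ∈↑⁺ ⊴-refl))))
      j<i : ∀ i → x j ⊴ y i → j F.< i
      j<i i xj⊴yi with Fₚ.<-cmp i j
      ... | tri< i<j _ _    = contradiction (⊴-trans xj⊴yi (proj₁ (proj₁ y-enum i j i<j))) xj⋬yj
      ... | tri≈ _ refl _   = contradiction xj⊴yi xj⋬yj
      ... | tri> _ _ j<i    = j<i
      i : ∀ {e} → e ∈ Q ∩ ↑ x j → Fin k
      i e∈ = index y-enum (proj₁ (x∈p∩q⁻ Q (↑ x j) e∈))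
      f : ∀ e → e ∈ Q ∩ ↑ x j → Fin n
      f _ e∈ = x (i e∈)
      f∈T : ∀ e e∈ → f e e∈ ∈ T
      f∈T e e∈ = x∈p∧x≢y⇒x∈p-y (x∈p∩q⁺ (incEnum-∈ x-enum (i e∈) , ∈↑⁺ (proj₁ xj◁xi))) (proj₂ xj◁xi ∘ sym)
        where
        xj⊴yi = subst (x j ⊴_) (sym (x[index]≡ y-enum _)) (∈↑⁻ (proj₂ (x∈p∩q⁻ Q (↑ x j) e∈)))
        xj◁xi = proj₁ x-enum j (i e∈) (j<i (i e∈) xj⊴yi)
      f-inj : ∀ e e′ e∈ e′∈ → f e e∈ ≡ f e′ e′∈ → e ≡ e′
      f-inj e e′ e∈ e′∈ fe≡fe′ = begin
        e            ≡⟨ sym (x[index]≡ y-enum _) ⟩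
        y (i e∈)     ≡⟨ cong y (incEnum-injective x-enum _ _ fe≡fe′) ⟩
        y (i e′∈)    ≡⟨ x[index]≡ y-enum _ ⟩
        e′           ∎
        where open ≡-Reasoning
      ∣Q∩↑xj∣≤∣T∣ : ∣ Q ∩ ↑ x j ∣ ≤ ∣ T ∣
      ∣Q∩↑xj∣≤∣T∣ = injection⇒∣p∣≤∣q∣ (Q ∩ ↑ x j) T f f∈T f-inj

  gale⇒upCountLeq : ∀ {P Q} → GaleLeq _⊴_ P Q → UpCountLeq P Q
  gale⇒upCountLeq {P} {Q} (∣P∣≡∣Q∣ , x⊴y) =
    let x , x-enum = incEnum ∣ P ∣ P refl
        y , y-enum = incEnum ∣ P ∣ Q (sym ∣P∣≡∣Q∣)
    in pointwise⇒upCountLeq x-enum y-enum (x⊴y ∣ P ∣ x y x-enum y-enum)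

  upCountLeq⇒gale : ∀ {P Q} → ∣ P ∣ ≡ ∣ Q ∣ → UpCountLeq P Q → GaleLeq _⊴_ P Q
  upCountLeq⇒gale ∣P∣≡∣Q∣ P≤Q = ∣P∣≡∣Q∣ , λ k x y x-enum y-enum → upCountLeq⇒pointwise x-enum y-enum P≤Q

  gale-trans : ∀ {P Q R} → GaleLeq _⊴_ P Q → GaleLeq _⊴_ Q R → GaleLeq _⊴_ P R
  gale-trans P≤Q Q≤R = upCountLeq⇒gale (trans (proj₁ P≤Q) (proj₁ Q≤R))
    (λ t → ≤-trans (gale⇒upCountLeq P≤Q t) (gale⇒upCountLeq Q≤R t))

  gale-∪ʳ : ∀ {P Q S} → Disjoint P S → Disjoint Q S → GaleLeq _⊴_ P Q → GaleLeq _⊴_ (P ∪ S) (Q ∪ S)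
  gale-∪ʳ {P} {Q} {S} P#S Q#S P≤Q = upCountLeq⇒gale ∣P∪S∣≡∣Q∪S∣ λ t → begin
    ∣ (P ∪ S) ∩ ↑ t ∣            ≡⟨ ∣[p∪q]∩r∣≡∣p∩r∣+∣q∩r∣ P S (↑ t) P#S ⟩
    ∣ P ∩ ↑ t ∣ + ∣ S ∩ ↑ t ∣    ≤⟨ +-monoˡ-≤ ∣ S ∩ ↑ t ∣ (gale⇒upCountLeq P≤Q t) ⟩
    ∣ Q ∩ ↑ t ∣ + ∣ S ∩ ↑ t ∣    ≡⟨ ∣[p∪q]∩r∣≡∣p∩r∣+∣q∩r∣ Q S (↑ t) Q#S ⟨
    ∣ (Q ∪ S) ∩ ↑ t ∣            ∎
    where
    open ≤-Reasoning
    ∣P∪S∣≡∣Q∪S∣ : ∣ P ∪ S ∣ ≡ ∣ Q ∪ S ∣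
    ∣P∪S∣≡∣Q∪S∣ = trans (∣p∪q∣≡∣p∣+∣q∣ P S P#S)
      (trans (cong (_+ ∣ S ∣) (proj₁ P≤Q)) (sym (∣p∪q∣≡∣p∣+∣q∣ Q S Q#S)))

module _ {Ind : Subset n → Set} where

  basis-size-bound : ∀ {B J} → IsBasis Ind B →
    (∣ B ∣ < ∣ J ∣ → ∃ λ e → e ∈ J × e ∉ B × Ind (⁅ e ⁆ ∪ B)) → ∣ J ∣ ≤ ∣ B ∣
  basis-size-bound {B} {J} (_ , B-max) augment with ∣ J ∣ ≤? ∣ B ∣
  ... | yes ∣J∣≤∣B∣ = ∣J∣≤∣B∣
  ... | no  ∣J∣≰∣B∣ =
    let e , _ , e∉B , e∪B-indep = augment (≰⇒> ∣J∣≰∣B∣)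
    in contradiction (subst (e ∈_) (B-max _ (q⊆p∪q ⁅ e ⁆ B) e∪B-indep) (x∈⁅x⁆∪p e B)) e∉B

  maximum-size⇒basis : ∀ {B} → Ind B → (∀ {J} → Ind J → ∣ J ∣ ≤ ∣ B ∣) → IsBasis Ind B
  maximum-size⇒basis B-indep size-bound =
    B-indep , λ J B⊆J J-indep → sym (p⊆q∧∣q∣≤∣p∣⇒p≡q B⊆J (size-bound J-indep))

  maximal⇒basis : (∀ {I J} → I ⊆ J → Ind J → Ind I) →
    ∀ {D} → Ind D → (∀ {e} → e ∉ D → ¬ Ind (⁅ e ⁆ ∪ D)) → IsBasis Ind D
  maximal⇒basis ind-down {D} D-indep D-maximal = D-indep , λ J D⊆J J-indep → ⊆-antisym (J⊆D D⊆J J-indep) D⊆J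
    where
    J⊆D : ∀ {J} → D ⊆ J → Ind J → J ⊆ D
    J⊆D D⊆J J-indep {e} e∈J with e ∈? D
    ... | yes e∈D = e∈D
    ... | no  e∉D = contradiction (ind-down (∪-lub (x∈p⇒⁅x⁆⊆p e∈J) D⊆J) J-indep) (D-maximal e∉D)

module _ (M : Matroid n) where

  basis-size : ∀ {B J} → IsBasis (Indep M) B → Indep M J → ∣ J ∣ ≤ ∣ B ∣
  basis-size B-basis J-indep = basis-size-bound B-basis (indep-aug M (proj₁ B-basis) J-indep)

  restriction-basis-size : ∀ {Y B J} → IsBasis (RestrictIndep M Y) B → RestrictIndep M Y J → ∣ J ∣ ≤ ∣ B ∣
  restriction-basis-size {Y} {B} {J} B-basis@((B⊆Y , B-indep) , _) (J⊆Y , J-indep) =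
    basis-size-bound B-basis augment
    where
    augment : ∣ B ∣ < ∣ J ∣ → ∃ λ e → e ∈ J × e ∉ B × RestrictIndep M Y (⁅ e ⁆ ∪ B)
    augment ∣B∣<∣J∣ =
      let e , e∈J , e∉B , e∪B-indep = indep-aug M B-indep J-indep ∣B∣<∣J∣
      in e , e∈J , e∉B , ∪-lub (x∈p⇒⁅x⁆⊆p (J⊆Y e∈J)) B⊆Y , e∪B-indep

  extend-to-basis : ∀ {B I} → IsBasis (Indep M) B → Indep M I → ∃ λ D → I ⊆ D × IsBasis (Indep M) D
  extend-to-basis {B} B-basis I-indep = go ∣ B ∣ I-indep (m≤n+m ∣ B ∣ _)
    where
    go : ∀ k {I} → Indep M I → ∣ B ∣ ≤ ∣ I ∣ + k → ∃ λ D → I ⊆ D × IsBasis (Indep M) D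
    go zero {I} I-indep ∣B∣≤∣I∣+0 = I , id , maximum-size⇒basis I-indep
      (λ J-indep → ≤-trans (basis-size B-basis J-indep) (subst (∣ B ∣ ≤_) (+-identityʳ ∣ I ∣) ∣B∣≤∣I∣+0))
    go (suc k) {I} I-indep ∣B∣≤∣I∣+1+k with ∣ B ∣ ≤? ∣ I ∣
    ... | yes ∣B∣≤∣I∣ = go zero I-indep (≤-trans ∣B∣≤∣I∣ (m≤m+n ∣ I ∣ 0))
    ... | no  ∣B∣≰∣I∣ =
      let e , _ , e∉I , e∪I-indep = indep-aug M I-indep (proj₁ B-basis) (≰⇒> ∣B∣≰∣I∣)
          ∣B∣≤∣e∪I∣+k = subst (λ s → ∣ B ∣ ≤ s + k) (sym (∣⁅x⁆∪p∣≡1+∣p∣ e∉I))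
                          (subst (∣ B ∣ ≤_) (+-suc ∣ I ∣ k) ∣B∣≤∣I∣+1+k)
          D , e∪I⊆D , D-basis = go k e∪I-indep ∣B∣≤∣e∪I∣+k
      in D , e∪I⊆D ∘ q⊆p∪q ⁅ e ⁆ I , D-basis

  module _ (indep? : ∀ I → Dec (Indep M I))
           {_⊴_ : Rel (Fin n) 0ℓ} (⊴-isTotalOrder : IsTotalOrder _≡_ _⊴_) where
    open GaleOrder ⊴-isTotalOrder
    open IsTotalOrder ⊴-isTotalOrder using () renaming (refl to ⊴-refl; trans to ⊴-trans)

    -- For every t, G ∩ ↑ t is a maximal independent subset of U ∩ ↑ t.
    IsGreedyIn : Subset n → Subset n → Set
    IsGreedyIn U G = G ⊆ U × Indep M G ×
      (∀ {t e} → e ∈ U → t ⊴ e → e ∉ G → ¬ Indep M (⁅ e ⁆ ∪ (G ∩ ↑ t)))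

    greedy : ∀ k U → ∣ U ∣ ≡ k → ∃ (IsGreedyIn U)
    greedy zero U ∣U∣≡0 = ⊥ , (⊥-elim ∘ ∉⊥) , indep-empty M , λ e∈U → contradiction e∈U (∣p∣≡0⇒x∉p ∣U∣≡0)
    greedy (suc k) U ∣U∣≡1+k with minimum U (∣p∣≡1+k⇒Nonempty U ∣U∣≡1+k)
    ... | m , m∈U , m-min with greedy k (U - m) (suc-injective (trans (sym (∣p∣≡1+∣p-x∣ m∈U)) ∣U∣≡1+k))
    ... | G , G⊆U-m , G-indep , G-greedy with indep? (⁅ m ⁆ ∪ G)
    ...   | yes m∪G-indep = ⁅ m ⁆ ∪ G , ∪-lub (x∈p⇒⁅x⁆⊆p m∈U) G⊆U , m∪G-indep , m∪G-greedy
      where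
      G⊆U : G ⊆ U
      G⊆U = p─q⊆p U _ ∘ G⊆U-m
      m∪G-greedy : ∀ {t e} → e ∈ U → t ⊴ e → e ∉ ⁅ m ⁆ ∪ G → ¬ Indep M (⁅ e ⁆ ∪ ((⁅ m ⁆ ∪ G) ∩ ↑ t))
      m∪G-greedy {t} {e} e∈U t⊴e e∉m∪G indep = G-greedy (x∈p∧x≢y⇒x∈p-y e∈U e≢m) t⊴e (e∉m∪G ∘ q⊆p∪q ⁅ m ⁆ G)
        (indep-down M (∪-lub (p⊆p∪q _) (q⊆p∪q ⁅ e ⁆ _ ∘ G∩↑t⊆m∪G∩↑t)) indep)
        where
        e≢m : e ≢ m
        e≢m refl = e∉m∪G (x∈⁅x⁆∪p e G)
        G∩↑t⊆m∪G∩↑t : G ∩ ↑ t ⊆ (⁅ m ⁆ ∪ G) ∩ ↑ t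
        G∩↑t⊆m∪G∩↑t x∈G∩↑t = let x∈G , x∈↑t = x∈p∩q⁻ G (↑ t) x∈G∩↑t in x∈p∩q⁺ (q⊆p∪q ⁅ m ⁆ G x∈G , x∈↑t)
    ...   | no  m∪G-dep = G , p─q⊆p U _ ∘ G⊆U-m , G-indep , G-greedy′
      where
      G-greedy′ : ∀ {t e} → e ∈ U → t ⊴ e → e ∉ G → ¬ Indep M (⁅ e ⁆ ∪ (G ∩ ↑ t))
      G-greedy′ {t} {e} e∈U t⊴e e∉G with e Fₚ.≟ m
      ... | no  e≢m = G-greedy (x∈p∧x≢y⇒x∈p-y e∈U e≢m) t⊴e e∉G
      ... | yes refl = m∪G-dep ∘ indep-down M (∪-lub (p⊆p∪q _) (q⊆p∪q ⁅ e ⁆ _ ∘ G⊆G∩↑t))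
        where
        G⊆G∩↑t : G ⊆ G ∩ ↑ t
        G⊆G∩↑t x∈G = x∈p∩q⁺ (x∈G , ∈↑⁺ (⊴-trans t⊴e (m-min (p─q⊆p U _ (G⊆U-m x∈G)))))

    galeBasis : ∃ (IsGaleBasis _⊴_ (Indep M))
    galeBasis with greedy n ⊤ (∣⊤∣≡n n)
    ... | G , _ , G-indep , G-greedy = G , G-basis , λ B B-basis →
      upCountLeq⇒gale (≤-antisym (basis-size G-basis (proj₁ B-basis)) (basis-size B-basis G-indep))
        (λ t → restriction-basis-size (G∩↑t-basis t)
                 ((λ {x} → p∩q⊆q B _) , indep-down M (p∩q⊆p B _) (proj₁ B-basis)))
      where
      G-basis : IsBasis (Indep M) G
      G-basis = maximal⇒basis (indep-down M) G-indep λ {e} e∉G e∪G-indep →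
        G-greedy ∈⊤ ⊴-refl e∉G (indep-down M (∪-lub (p⊆p∪q _) (q⊆p∪q ⁅ e ⁆ G ∘ p∩q⊆p G _)) e∪G-indep)
      G∩↑t-basis : ∀ t → IsBasis (RestrictIndep M (↑ t)) (G ∩ ↑ t)
      G∩↑t-basis t = maximal⇒basis (λ I⊆J (J⊆↑t , J-indep) → J⊆↑t ∘ I⊆J , indep-down M I⊆J J-indep)
        ((λ {x} → p∩q⊆q G _) , indep-down M (p∩q⊆p G _) G-indep)
        λ {e} e∉G∩↑t (e∪G∩↑t⊆↑t , e∪G∩↑t-indep) →
          let e∈↑t = e∪G∩↑t⊆↑t (x∈⁅x⁆∪p e _)
          in G-greedy ∈⊤ (∈↑⁻ e∈↑t) (λ e∈G → e∉G∩↑t (x∈p∩q⁺ (e∈G , e∈↑t))) e∪G∩↑t-indep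

any-function? : ∀ n m (P : (Fin n → Fin m) → Set) → (∀ {f g} → (∀ i → f i ≡ g i) → P f → P g) →
  (∀ f → Dec (P f)) → Dec (∃ P)
any-function? zero    m P P-resp P? = map′ (_ ,_) (λ (f , Pf) → P-resp (λ ()) Pf) (P? (λ ()))
any-function? (suc n) m P P-resp P? =
  map′ (λ (a , f , P[a∷f]) → a Vector.∷ f , P[a∷f])
       (λ (f , Pf) → f zero , f ∘ suc , P-resp (λ { zero → refl ; (suc i) → refl }) Pf)
       (Fₚ.any? λ a → any-function? n m (P ∘ (a Vector.∷_))
          (λ f≗g → P-resp λ { zero → refl ; (suc i) → f≗g i }) (P? ∘ (a Vector.∷_)))

IsMatching : (Fin m → Subset n) → Subset n → (Fin n → Fin m) → Set
IsMatching A I f = (∀ e → e ∈ I → e ∈ A (f e)) × (∀ e e′ → e ∈ I → e′ ∈ I → f e ≡ f e′ → e ≡ e′)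

isMatching-resp : ∀ {A : Fin m → Subset n} {I f g} → (∀ i → f i ≡ g i) → IsMatching A I f → IsMatching A I g
isMatching-resp {A = A} f≗g (f-into , f-inj) =
  (λ e e∈I → subst (λ j → e ∈ A j) (f≗g e) (f-into e e∈I)) ,
  (λ e e′ e∈I e′∈I ge≡ge′ → f-inj e e′ e∈I e′∈I (trans (f≗g e) (trans ge≡ge′ (sym (f≗g e′)))))

isMatching? : ∀ (A : Fin m → Subset n) I f → Dec (IsMatching A I f)
isMatching? A I f =
  Fₚ.all? (λ e → e ∈? I →-dec e ∈? A (f e)) ×-dec
  Fₚ.all? (λ e → Fₚ.all? λ e′ → e ∈? I →-dec (e′ ∈? I →-dec (f e Fₚ.≟ f e′ →-dec e Fₚ.≟ e′)))

matchesInto? : ∀ (A : Fin m → Subset n) I → Dec (MatchesInto A I)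
matchesInto? {zero} A I = map′
  (λ I-empty → (λ e e∈I → ⊥-elim (I-empty (e , e∈I))) , (λ e e∈I → ⊥-elim (I-empty (e , e∈I))) ,
               λ e _ e∈I _ _ → ⊥-elim (I-empty (e , e∈I)))
  (λ (φ , _) (e , e∈I) → Fₚ.¬Fin0 (φ e e∈I))
  (¬? (nonempty? I))
matchesInto? {suc m} {n} A I = map′
  (λ (f , f-matching) → (λ e _ → f e) , f-matching)
  (λ φm → total (proj₁ φm) , total-matching φm)
  (any-function? n (suc m) (IsMatching A I) (isMatching-resp {A = A}) (isMatching? A I))
  where
  total : (∀ e → e ∈ I → Fin (suc m)) → Fin n → Fin (suc m)
  total φ e with e ∈? I
  ... | yes e∈I = φ e e∈I
  ... | no  _   = zero
  total-matching : (φm : MatchesInto A I) → IsMatching A I (total (proj₁ φm))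
  total-matching (φ , φ-into , φ-inj) = into , inj
    where
    into : ∀ e → e ∈ I → e ∈ A (total φ e)
    into e e∈I with e ∈? I
    ... | yes e∈I′ = φ-into e e∈I′
    ... | no  e∉I  = contradiction e∈I e∉I
    inj : ∀ e e′ → e ∈ I → e′ ∈ I → total φ e ≡ total φ e′ → e ≡ e′
    inj e e′ e∈I e′∈I with e ∈? I | e′ ∈? I
    ... | yes e∈I′ | yes e′∈I′ = φ-inj e e′ e∈I′ e′∈I′
    ... | no  e∉I  | _         = contradiction e∈I e∉I
    ... | _        | no  e′∉I  = contradiction e′∈I e′∉I

indep? : (M : Matroid n) → IsNested M → ∀ I → Dec (Indep M I)
indep? M (_ , A , _ , indep⇔matching) I =
  map′ (Equivalence.from (indep⇔matching I)) (Equivalence.to (indep⇔matching I)) (matchesInto? A I)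

module _ (M : Matroid n) (X Y : Subset n) where

  minor-basis-size : ∀ {G J} → IsBasis (MinorIndep M X Y) G → MinorIndep M X Y J → ∣ J ∣ ≤ ∣ G ∣
  minor-basis-size {G} {J} G-basis@((G⊆E′ , BY , BY-basis , G∪BY-indep) , _)
                           (J⊆E′ , BY′ , BY′-basis , J∪BY′-indep) =
    basis-size-bound G-basis augment
    where
    E′⊆∁Y : ∀ {e} → e ∈ ∁ (X ∪ Y) → e ∉ Y
    E′⊆∁Y e∈E′ = x∈∁p⇒x∉p e∈E′ ∘ q⊆p∪q X Y
    ∣G∪BY∣<∣J∪BY′∣ : ∣ G ∣ < ∣ J ∣ → ∣ G ∪ BY ∣ < ∣ J ∪ BY′ ∣
    ∣G∪BY∣<∣J∪BY′∣ ∣G∣<∣J∣ = begin-strict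
      ∣ G ∪ BY ∣       ≡⟨ ∣p∪q∣≡∣p∣+∣q∣ G BY (λ e∈G → E′⊆∁Y (G⊆E′ e∈G) ∘ proj₁ (proj₁ BY-basis)) ⟩
      ∣ G ∣ + ∣ BY ∣   <⟨ +-mono-<-≤ ∣G∣<∣J∣ (restriction-basis-size M BY′-basis (proj₁ BY-basis)) ⟩
      ∣ J ∣ + ∣ BY′ ∣  ≡⟨ ∣p∪q∣≡∣p∣+∣q∣ J BY′ (λ e∈J → E′⊆∁Y (J⊆E′ e∈J) ∘ proj₁ (proj₁ BY′-basis)) ⟨
      ∣ J ∪ BY′ ∣      ∎
      where open ≤-Reasoning
    augment : ∣ G ∣ < ∣ J ∣ → ∃ λ e → e ∈ J × e ∉ G × MinorIndep M X Y (⁅ e ⁆ ∪ G)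
    augment ∣G∣<∣J∣ with indep-aug M G∪BY-indep J∪BY′-indep (∣G∪BY∣<∣J∪BY′∣ ∣G∣<∣J∣)
    ... | e , e∈J∪BY′ , e∉G∪BY , e∪G∪BY-indep with e ∈? Y
    ...   | yes e∈Y = contradiction (q⊆p∪q G BY e∈BY) e∉G∪BY
      where
      e∈BY : e ∈ BY
      e∈BY = subst (e ∈_)
        (proj₂ BY-basis _ (q⊆p∪q ⁅ e ⁆ BY)
          (∪-lub (x∈p⇒⁅x⁆⊆p e∈Y) (proj₁ (proj₁ BY-basis)) ,
           indep-down M (∪-lub (p⊆p∪q _) (q⊆p∪q ⁅ e ⁆ _ ∘ q⊆p∪q G BY)) e∪G∪BY-indep))
        (x∈⁅x⁆∪p e BY)
    ...   | no  e∉Y with x∈p∪q⁻ J BY′ e∈J∪BY′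
    ...     | inj₂ e∈BY′ = contradiction (proj₁ (proj₁ BY′-basis) e∈BY′) e∉Y
    ...     | inj₁ e∈J   = e , e∈J , e∉G∪BY ∘ p⊆p∪q BY ,
      ∪-lub (x∈p⇒⁅x⁆⊆p (J⊆E′ e∈J)) G⊆E′ , BY , BY-basis , subst (Indep M) (sym (∪-assoc ⁅ e ⁆ G BY)) e∪G∪BY-indep

module _ (M : Matroid n) (M-indep? : ∀ I → Dec (Indep M I))
         {_⊴_ : Rel (Fin n) 0ℓ} (⊴-isTotalOrder : IsTotalOrder _≡_ _⊴_)
         (M-leftJustified : IsLeftJustified M _⊴_) (X Y : Subset n) where
  open GaleOrder ⊴-isTotalOrder

  galeBelow⇒minorBasis : ∀ {G B} → IsBasis (MinorIndep M X Y) G → B ⊆ ∁ (X ∪ Y) →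
    GaleLeq _⊴_ B G → IsBasis (MinorIndep M X Y) B
  galeBelow⇒minorBasis {G} {B} G-basis@((G⊆E′ , BY , BY-basis , G∪BY-indep) , G-max) B⊆E′ B≤G
    with galeBasis M M-indep? ⊴-isTotalOrder
  ... | GM , GM-basis , GM-max with extend-to-basis M GM-basis G∪BY-indep
  ... | D , G∪BY⊆D , D-basis =
    maximum-size⇒basis ((λ {x} → B⊆E′) , BY , BY-basis , B∪BY-indep)
      (λ J-indep → ≤-trans (minor-basis-size M X Y G-basis J-indep) (≤-reflexive (sym (proj₁ B≤G))))
    where
    S : Subset _
    S = D ─ G

    D∩E′⊆G : ∀ {e} → e ∈ D → e ∈ ∁ (X ∪ Y) → e ∈ G
    D∩E′⊆G {e} e∈D e∈E′ with e ∈? G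
    ... | yes e∈G = e∈G
    ... | no  e∉G = contradiction (subst (e ∈_) (G-max _ (q⊆p∪q ⁅ e ⁆ G) e∪G-minorIndep) (x∈⁅x⁆∪p e G)) e∉G
      where
      e∪G-minorIndep : MinorIndep M X Y (⁅ e ⁆ ∪ G)
      e∪G-minorIndep = ∪-lub (x∈p⇒⁅x⁆⊆p e∈E′) G⊆E′ , BY , BY-basis ,
        indep-down M (subst (_⊆ D) (sym (∪-assoc ⁅ e ⁆ G BY)) (∪-lub (x∈p⇒⁅x⁆⊆p e∈D) G∪BY⊆D)) (proj₁ D-basis)

    B#S : Disjoint B S
    B#S e∈B e∈S = x∈p─q⇒x∉q D G e∈S (D∩E′⊆G (p─q⊆p D G e∈S) (B⊆E′ e∈B))

    B∪S≤D : GaleLeq _⊴_ (B ∪ S) D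
    B∪S≤D = subst (GaleLeq _⊴_ (B ∪ S)) (p⊆q⇒p∪[q─p]≡q (G∪BY⊆D ∘ p⊆p∪q BY))
      (gale-∪ʳ B#S (λ e∈G e∈S → x∈p─q⇒x∉q D G e∈S e∈G) B≤G)

    B∪S-basis : IsBasis (Indep M) (B ∪ S)
    B∪S-basis = Equivalence.from
      (M-leftJustified GM (GM-basis , GM-max) (B ∪ S) (D , D-basis , sym (proj₁ B∪S≤D)))
      (gale-trans B∪S≤D (GM-max D D-basis))

    BY⊆S : BY ⊆ S
    BY⊆S e∈BY = x∈p∧x∉q⇒x∈p─q (G∪BY⊆D (q⊆p∪q G BY e∈BY))
      λ e∈G → x∈∁p⇒x∉p (G⊆E′ e∈G) (q⊆p∪q X Y (proj₁ (proj₁ BY-basis) e∈BY))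

    B∪BY-indep : Indep M (B ∪ BY)
    B∪BY-indep = indep-down M (∪-lub (p⊆p∪q S) (q⊆p∪q B S ∘ BY⊆S)) (proj₁ B∪S-basis)

lemma4p6 : ∀ {n : ℕ} (M : Matroid n) → IsNested M →
    (_⊴_ : Rel (Fin n) 0ℓ) → IsTotalOrder _≡_ _⊴_ →
    IsLeftJustified M _⊴_ →
    ∀ (X Y : Subset n) → X ∩ Y ≡ ⊥ →
    ∀ (B : Subset n) → B ⊆ ∁ (X ∪ Y) →
    HasRank (MinorIndep M X Y) ∣ B ∣ →
    ∀ (G : Subset n) → IsGaleBasis _⊴_ (MinorIndep M X Y) G →
    (IsBasis (MinorIndep M X Y) B ⇔ GaleLeq _⊴_ B G)
lemma4p6 M M-nested _⊴_ ⊴-isTotalOrder M-leftJustified X Y _ B B⊆E′ _ G (G-basis , G-max) =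
  mk⇔ (G-max B) (galeBelow⇒minorBasis M (indep? M M-nested) ⊴-isTotalOrder M-leftJustified X Y G-basis B⊆E′)
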